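{- For any $r, s, k\in\mathbb N$, we have $C(r+s) \ge C(r, s)$ and $C(k+1) > C(k)$.
   Context: A permutation of length $n\ge0$ is a bijection $\pi$ of $[n]$, written as $\pi(1)\ldots\pi(n)$. $\pi$ contains $\tau$ ($\tau$ is a pattern of $\pi$) if $\pi$ has a subsequence in the same relative order as $\tau$; proper if $\tau$ is shorter than $\pi$. $\mathbb N=\{0,1,2,\dots\}$. For $r,s\in\mathbb N$, $\pi$ is $(r,s)$-coverable if its terms can be partitioned into $r$ increasing and $s$ decreasing (possibly empty) subsequences; $k$-coverable if $(r,s)$-coverable for some $r+s=k$. $\pi$ is $(r,s)$-critical (resp. $k$-critical) if it is not $(r,s)$-coverable (resp. $k$-coverable) but every proper pattern is. $C(r,s)$ and $C(k)$ denote the largest length of an $(r,s)$-critical, resp. $k$-critical, permutation (these are finite). -}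

module Defs where

open import Data.Nat using (ℕ; _+_; _<_; _≤_)
open import Data.Fin using (Fin) renaming (_<_ to _<ᶠ_)
open import Data.Fin.Permutation using (Permutation′; _⟨$⟩ʳ_)
open import Data.Sum using (_⊎_; inj₁; inj₂)
open import Data.Product using (Σ; ∃; _×_)
open import Relation.Binary.PropositionalEquality using (_≡_)
open import Relation.Nullary using (¬_)
open import Function.Bundles using (_⇔_)

-- A permutation of length n: a bijection of Fin n (i.e. of [n]),
-- one-line notation π(1)…π(n) read off from π ⟨$⟩ʳ i.
Perm : ℕ → Set
Perm n = Permutation′ n

Contains : ∀ {n m} → Perm n → Perm m → Set
Contains {n} {m} π σ =
  Σ (Fin m → Fin n) λ f →
    (∀ i j → i <ᶠ j → f i <ᶠ f j) ×
    (∀ i j → ((σ ⟨$⟩ʳ i) <ᶠ (σ ⟨$⟩ʳ j)) ⇔ ((π ⟨$⟩ʳ f i) <ᶠ (π ⟨$⟩ʳ f j)))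

-- (r,s)-coverable: the positions are partitioned (by a colouring) into r
-- increasing subsequences (colours inj₁ a) and s decreasing ones (colours inj₂ b);
-- classes may be empty.
Coverable : ℕ → ℕ → ∀ {n} → Perm n → Set
Coverable r s {n} π =
  Σ (Fin n → Fin r ⊎ Fin s) λ c →
    (∀ i j a → i <ᶠ j → c i ≡ inj₁ a → c j ≡ inj₁ a → (π ⟨$⟩ʳ i) <ᶠ (π ⟨$⟩ʳ j)) ×
    (∀ i j b → i <ᶠ j → c i ≡ inj₂ b → c j ≡ inj₂ b → (π ⟨$⟩ʳ j) <ᶠ (π ⟨$⟩ʳ i))

KCoverable : ℕ → ∀ {n} → Perm n → Set
KCoverable k π = Σ ℕ λ r → Σ ℕ λ s → (r + s ≡ k) × Coverable r s π

Critical : ℕ → ℕ → ∀ {n} → Perm n → Set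
Critical r s {n} π =
  ¬ Coverable r s π ×
  (∀ {m} (σ : Perm m) → m < n → Contains π σ → Coverable r s σ)

KCritical : ℕ → ∀ {n} → Perm n → Set
KCritical k {n} π =
  ¬ KCoverable k π ×
  (∀ {m} (σ : Perm m) → m < n → Contains π σ → KCoverable k σ)

IsGreatest : (ℕ → Set) → ℕ → Set
IsGreatest P n = P n × (∀ m → P m → m ≤ n)

-- "C(r,s) = c": c is the largest length of an (r,s)-critical permutation.
IsC₂ : ℕ → ℕ → ℕ → Set
IsC₂ r s = IsGreatest (λ n → Σ (Perm n) (Critical r s))

-- "C(k) = c": c is the largest length of a k-critical permutation.
IsC : ℕ → ℕ → Set
IsC k = IsGreatest (λ n → Σ (Perm n) (KCritical k))

module Submission where

-- Let π be (r,s)-critical. After π put, below it, s decreasing runs arranged increasingly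
-- and, above everything, r increasing runs arranged decreasingly, all of length r + s + 1.
-- In a covering of the result τ by r + s classes each run contains two points of one class
-- (pigeonhole), so each increasing run needs an increasing class used by no other run and
-- each decreasing run a decreasing one: the covering is an (r,s)-covering and would cover π.
-- So τ contains an (r+s)-critical pattern σ. For every point p of π, π − p is
-- (r,s)-coverable; letting the runs join its classes and adding {p} as an extra class gives
-- a covering of τ by r + s classes plus {p}, which σ must therefore meet. Thus σ contains
-- all of π, and C(r,s) ≤ C(r+s).
-- For C(k) < C(k+1), follow a k-critical π by one increasing run of length k + 2 below it.
-- The same argument shows that a (k+1)-critical pattern contains all of π, and it also
-- meets the run because π alone is (k+1)-coverable; hence it is longer than π.

open import Defs
open import Data.Nat as ℕ using (ℕ; zero; suc; _+_; _*_; _∸_; _^_; _≤_; _<_; z≤n; s≤s)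
import Data.Nat.Properties as ℕ
open import Data.Fin
  using (Fin; zero; suc; toℕ; fromℕ<; _↑ˡ_; _↑ʳ_; splitAt; join; opposite; punchIn; punchOut; finToFun; funToFin)
  renaming (_<_ to _<ᶠ_)
import Data.Fin.Properties as Finₚ
open import Data.Fin.Permutation using (_⟨$⟩ʳ_; permutation; _∘ₚ_; id; remove)
open import Data.Vec.Functional using (_∷_; _++_; insertAt)
open import Data.Vec.Functional.Properties using (lookup-++ˡ; lookup-++ʳ; insertAt-lookup; insertAt-punchIn)
open import Data.Sum as Sum using (_⊎_; inj₁; inj₂; [_,_]; swap)
import Data.Sum.Properties as Sumₚ
open import Data.Sum.Function.Propositional using (_⊎-↔_)
open import Data.Product using (Σ; ∃; ∃₂; _×_; _,_; proj₁; proj₂)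
open import Data.Empty using (⊥-elim)
open import Function using (_∘_; _⇔_; mk⇔; Injective)
open import Function.Bundles using (Equivalence)
open import Function.Properties.Inverse using (↔-sym; ↔-trans)
open import Function.Construct.Composition using (_⇔-∘_)
open import Function.Construct.Symmetry using (⇔-sym)
open import Relation.Binary.PropositionalEquality using (_≡_; _≢_; refl; sym; trans; cong; cong₂; subst; subst₂)
open import Relation.Nullary using (¬_; Dec; yes; no; contradiction)
open import Relation.Nullary.Decidable using (map′; _→-dec_; ¬?; decidable-stable)

private
  variable
    r s r′ s′ k m n M N N′ : ℕ

-- Coverings of value sequences

ClassOrder : Fin r ⊎ Fin s → Fin N → Fin N → Set
ClassOrder (inj₁ _) x y = x <ᶠ y
ClassOrder (inj₂ _) x y = y <ᶠ x

IsCovering : ∀ r s → (Fin n → Fin N) → (Fin n → Fin r ⊎ Fin s) → Set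
IsCovering r s w c = ∀ i j → i <ᶠ j → c i ≡ c j → ClassOrder (c i) (w i) (w j)

coverable⇒isCovering : {π : Perm n} → Coverable r s π → ∃ (IsCovering r s (π ⟨$⟩ʳ_))
coverable⇒isCovering {r = r} {s = s} {π = π} (c , increasing , decreasing) = c , covering
  where
  covering : IsCovering r s (π ⟨$⟩ʳ_) c
  covering i j i<j ci≡cj = inClass (c i) refl (sym ci≡cj)
    where
    inClass : ∀ u → c i ≡ u → c j ≡ u → ClassOrder u (π ⟨$⟩ʳ i) (π ⟨$⟩ʳ j)
    inClass (inj₁ a) = increasing i j a i<j
    inClass (inj₂ b) = decreasing i j b i<j

isCovering⇒coverable : {π : Perm n} {c : Fin n → Fin r ⊎ Fin s} →
                       IsCovering r s (π ⟨$⟩ʳ_) c → Coverable r s π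
isCovering⇒coverable {π = π} {c = c} covering = c , (λ i j _ → inClass i j) , (λ i j _ → inClass i j)
  where
  inClass : ∀ i j {u} → i <ᶠ j → c i ≡ u → c j ≡ u → ClassOrder u (π ⟨$⟩ʳ i) (π ⟨$⟩ʳ j)
  inClass i j i<j ci≡ cj≡ = subst (λ u → ClassOrder u _ _) ci≡ (covering i j i<j (trans ci≡ (sym cj≡)))

isCovering-cong : {w : Fin n → Fin N} {c c′ : Fin n → Fin r ⊎ Fin s} →
                  (∀ i → c i ≡ c′ i) → IsCovering r s w c → IsCovering r s w c′
isCovering-cong c≗c′ covering i j i<j c′i≡c′j =
  subst (λ u → ClassOrder u _ _) (c≗c′ i)
    (covering i j i<j (trans (c≗c′ i) (trans c′i≡c′j (sym (c≗c′ j)))))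

isCovering-pullback : {w : Fin n → Fin N} {v : Fin m → Fin N′} {c : Fin n → Fin r ⊎ Fin s}
  (f : Fin m → Fin n) → (∀ i j → i <ᶠ j → f i <ᶠ f j) → (∀ i j → w (f i) <ᶠ w (f j) → v i <ᶠ v j) →
  IsCovering r s w c → IsCovering r s v (c ∘ f)
isCovering-pullback {w = w} {v = v} {c = c} f f-mono reflect covering i j i<j same =
  transfer (c (f i)) (covering (f i) (f j) (f-mono i j i<j) same)
  where
  transfer : ∀ u → ClassOrder u (w (f i)) (w (f j)) → ClassOrder u (v i) (v j)
  transfer (inj₁ _) = reflect i j
  transfer (inj₂ _) = reflect j i

isCovering-reverse : {w : Fin n → Fin N} {v : Fin n → Fin N′} {c : Fin n → Fin r ⊎ Fin s} →
  (∀ i j → w i <ᶠ w j → v j <ᶠ v i) → IsCovering r s w c → IsCovering s r v (swap ∘ c)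
isCovering-reverse {w = w} {v = v} {c = c} reverse covering i j i<j same =
  transfer (c i) (covering i j i<j (swap-injective same))
  where
  swap-injective : ∀ {x y} → swap x ≡ swap y → x ≡ y
  swap-injective {x} {y} eq =
    trans (sym (Sumₚ.swap-involutive x)) (trans (cong swap eq) (Sumₚ.swap-involutive y))
  transfer : ∀ u → ClassOrder u (w i) (w j) → ClassOrder (swap u) (v i) (v j)
  transfer (inj₁ _) = reverse i j
  transfer (inj₂ _) = reverse j i

isCovering-relabel : {w : Fin n → Fin N} {c : Fin n → Fin r ⊎ Fin s} {c′ : Fin n → Fin r′ ⊎ Fin s′} →
  (∀ i j → c′ i ≡ c′ j → c i ≡ c j) → (∀ i {x y : Fin N} → ClassOrder (c i) x y → ClassOrder (c′ i) x y) →
  IsCovering r s w c → IsCovering r′ s′ w c′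
isCovering-relabel unmerged sameSide covering i j i<j same =
  sameSide i (covering i j i<j (unmerged i j same))

isCovering-map : {w : Fin n → Fin N} {c : Fin n → Fin r ⊎ Fin s}
  {f : Fin r → Fin r′} {g : Fin s → Fin s′} → Injective _≡_ _≡_ f → Injective _≡_ _≡_ g →
  IsCovering r s w c → IsCovering r′ s′ w (Sum.map f g ∘ c)
isCovering-map {c = c} {f} {g} f-injective g-injective =
  isCovering-relabel (λ i j → map-injective (c i) (c j)) (λ i → sameSide (c i))
  where
  map-injective : ∀ u v → Sum.map f g u ≡ Sum.map f g v → u ≡ v
  map-injective (inj₁ _) (inj₁ _) eq = cong inj₁ (f-injective (Sumₚ.inj₁-injective eq))
  map-injective (inj₂ _) (inj₂ _) eq = cong inj₂ (g-injective (Sumₚ.inj₂-injective eq))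
  sameSide : ∀ u {x y : Fin N} → ClassOrder u x y → ClassOrder (Sum.map f g u) x y
  sameSide (inj₁ _) x<y = x<y
  sameSide (inj₂ _) y<x = y<x

dropColour : (a : Fin (suc r)) (u : Fin (suc r) ⊎ Fin s) → u ≢ inj₁ a → Fin r ⊎ Fin s
dropColour a (inj₁ x) u≢a = inj₁ (punchOut (u≢a ∘ cong inj₁ ∘ sym))
dropColour a (inj₂ y) _   = inj₂ y

isCovering-dropColour : {w : Fin n → Fin N} {c : Fin n → Fin (suc r) ⊎ Fin s} (a : Fin (suc r)) →
  (avoids : ∀ i → c i ≢ inj₁ a) → IsCovering (suc r) s w c →
  IsCovering r s w (λ i → dropColour a (c i) (avoids i))
isCovering-dropColour {c = c} a avoids =
  isCovering-relabel (λ i j → drop-injective (c i) (c j) (avoids i) (avoids j)) (λ i → sameSide (c i) (avoids i))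
  where
  drop-injective : ∀ u v u≢a v≢a → dropColour a u u≢a ≡ dropColour a v v≢a → u ≡ v
  drop-injective (inj₁ _) (inj₁ _) u≢a v≢a eq =
    cong inj₁ (Finₚ.punchOut-injective (u≢a ∘ cong inj₁ ∘ sym) (v≢a ∘ cong inj₁ ∘ sym) (Sumₚ.inj₁-injective eq))
  drop-injective (inj₂ _) (inj₂ _) _ _ eq = cong inj₂ (Sumₚ.inj₂-injective eq)
  sameSide : ∀ u u≢a {x y : Fin N} → ClassOrder u x y → ClassOrder (dropColour a u u≢a) x y
  sameSide (inj₁ _) _ x<y = x<y
  sameSide (inj₂ _) _ y<x = y<x

isCovering-constant : {w : Fin n → Fin N} → (∀ i j → i <ᶠ j → w i <ᶠ w j) →
                      (a : Fin r) → IsCovering r s w (λ _ → inj₁ a)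
isCovering-constant increasing a i j i<j _ = increasing i j i<j

-- Pigeonhole: two points of an increasing run share a class, which must then be increasing.
increasing-run-inj₁ : {w : Fin n → Fin N} {c : Fin n → Fin r ⊎ Fin s} →
  (∀ i j → i <ᶠ j → w i <ᶠ w j) → r + s < n → IsCovering r s w c → ∃₂ λ i a → c i ≡ inj₁ a
increasing-run-inj₁ {r = r} {s = s} {w = w} {c = c} increasing r+s<n covering
  with i , j , i<j , same ← Finₚ.pigeonhole r+s<n (join r s ∘ c) =
  inClass (c i) refl (covering i j i<j (join-injective same))
  where
  join-injective : ∀ {u v} → join r s u ≡ join r s v → u ≡ v
  join-injective {u} {v} eq =
    trans (sym (Finₚ.splitAt-join r s u)) (trans (cong (splitAt r) eq) (Finₚ.splitAt-join r s v))
  inClass : ∀ u → c i ≡ u → ClassOrder u (w i) (w j) → ∃₂ λ i a → c i ≡ inj₁ a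
  inClass (inj₁ a) ci≡ _   = i , a , ci≡
  inClass (inj₂ _) _   w<w = contradiction w<w (Finₚ.<-asym (increasing i j i<j))

contains-refl : (π : Perm n) → Contains π π
contains-refl π = (λ i → i) , (λ _ _ i<j → i<j) , (λ _ _ → mk⇔ (λ x → x) (λ x → x))

contains-trans : {π : Perm n} {ρ : Perm m} {σ : Perm k} → Contains π ρ → Contains ρ σ → Contains π σ
contains-trans (f , f-mono , f-iso) (g , g-mono , g-iso) =
  f ∘ g , (λ i j i<j → f-mono (g i) (g j) (g-mono i j i<j)) , (λ i j → f-iso (g i) (g j) ⇔-∘ g-iso i j)

isCovering-pattern : {π : Perm n} {σ : Perm m} {c : Fin n → Fin r ⊎ Fin s} (e : Contains π σ) →
  IsCovering r s (π ⟨$⟩ʳ_) c → IsCovering r s (σ ⟨$⟩ʳ_) (c ∘ proj₁ e)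
isCovering-pattern (f , f-mono , f-iso) =
  isCovering-pullback f f-mono (λ i j → Equivalence.from (f-iso i j))

punchIn-<⇔ : (p : Fin (suc n)) {i j : Fin n} → (i <ᶠ j) ⇔ (punchIn p i <ᶠ punchIn p j)
punchIn-<⇔ p {i} {j} = mk⇔
  (λ i<j → Finₚ.≤∧≢⇒< (Finₚ.punchIn-mono-≤ p i j (ℕ.<⇒≤ i<j))
                       (Finₚ.<⇒≢ i<j ∘ Finₚ.punchIn-injective p i j))
  (λ p<p → Finₚ.≤∧≢⇒< (Finₚ.punchIn-cancel-≤ p i j (ℕ.<⇒≤ p<p))
                       (λ { refl → Finₚ.<-irrefl refl p<p }))

punchOut-<⇔ : {p i j : Fin (suc n)} (p≢i : p ≢ i) (p≢j : p ≢ j) → (i <ᶠ j) ⇔ (punchOut p≢i <ᶠ punchOut p≢j)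
punchOut-<⇔ {p = p} p≢i p≢j = mk⇔
  (λ i<j → Finₚ.≤∧≢⇒< (Finₚ.punchOut-mono-≤ p≢i p≢j (ℕ.<⇒≤ i<j))
                       (Finₚ.<⇒≢ i<j ∘ Finₚ.punchOut-injective p≢i p≢j))
  (λ p<p → Finₚ.≤∧≢⇒< (Finₚ.punchOut-cancel-≤ p≢i p≢j (ℕ.<⇒≤ p<p))
                       (λ { refl → Finₚ.<-irrefl (Finₚ.punchOut-cong p refl) p<p }))

remove-<⇔ : (p : Fin (suc n)) (π : Perm (suc n)) {i j : Fin n} →
  (remove p π ⟨$⟩ʳ i <ᶠ remove p π ⟨$⟩ʳ j) ⇔ (π ⟨$⟩ʳ punchIn p i <ᶠ π ⟨$⟩ʳ punchIn p j)
remove-<⇔ p π {i} {j} =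
  ⇔-sym (punchOut-<⇔ {p = π ⟨$⟩ʳ p} {i = π ⟨$⟩ʳ punchIn p i} {j = π ⟨$⟩ʳ punchIn p j} _ _)

contains-remove : (p : Fin (suc n)) (π : Perm (suc n)) → Contains π (remove p π)
contains-remove p π = punchIn p , (λ _ _ → Equivalence.to (punchIn-<⇔ p)) , (λ _ _ → remove-<⇔ p π)

data PunchView (p : Fin (suc n)) : Fin (suc n) → Set where
  at      : PunchView p p
  punched : ∀ j → PunchView p (punchIn p j)

punchView : (p i : Fin (suc n)) → PunchView p i
punchView p i with i Finₚ.≟ p
... | yes refl = at
... | no  i≢p  = subst (PunchView p) (Finₚ.punchIn-punchOut (i≢p ∘ sym)) (punched _)

isCovering-insertAt : {w : Fin (suc n) → Fin N} {c : Fin n → Fin r ⊎ Fin s} (p : Fin (suc n)) (x : Fin r ⊎ Fin s) →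
  (∀ j → c j ≢ x) → IsCovering r s (w ∘ punchIn p) c → IsCovering r s w (insertAt c p x)
isCovering-insertAt {w = w} {c = c} p x fresh covering i j i<j same with punchView p i | punchView p j
... | at        | at        = contradiction i<j (Finₚ.<-irrefl refl)
... | at        | punched j′ =
  contradiction (trans (sym (insertAt-lookup c p x)) (trans same (insertAt-punchIn c p x j′))) (fresh j′ ∘ sym)
... | punched i′ | at        =
  contradiction (trans (sym (insertAt-punchIn c p x i′)) (trans same (insertAt-lookup c p x))) (fresh i′)
... | punched i′ | punched j′ =
  subst (λ u → ClassOrder u (w (punchIn p i′)) (w (punchIn p j′))) (sym (insertAt-punchIn c p x i′))
    (covering i′ j′ (Equivalence.from (punchIn-<⇔ p) i<j)
      (trans (sym (insertAt-punchIn c p x i′)) (trans same (insertAt-punchIn c p x j′))))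

FreshCovering : ∀ r s {n} → Perm n → Fin n → Set
FreshCovering r s {n} π p =
  Σ (Fin n → Fin (suc r) ⊎ Fin s) λ c → IsCovering (suc r) s (π ⟨$⟩ʳ_) c × (∀ i → c i ≡ inj₁ zero → i ≡ p)

remove-coverable⇒freshCovering : (p : Fin (suc n)) (π : Perm (suc n)) →
  Coverable r s (remove p π) → FreshCovering r s π p
remove-coverable⇒freshCovering {n = n} {r = r} {s = s} p π coverable =
  insertAt lifted p (inj₁ zero) , isCovering-insertAt p (inj₁ zero) lifted≢zero lifted-covering , onlyAt-p
  where
  covering : ∃ (IsCovering r s (remove p π ⟨$⟩ʳ_))
  covering = coverable⇒isCovering {π = remove p π} coverable
  c : Fin n → Fin r ⊎ Fin s
  c = proj₁ covering
  lifted : Fin n → Fin (suc r) ⊎ Fin s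
  lifted = Sum.map suc (λ b → b) ∘ c
  lifted≢zero : ∀ j → lifted j ≢ inj₁ zero
  lifted≢zero j with c j
  ... | inj₁ _ = λ ()
  ... | inj₂ _ = λ ()
  lifted-covering : IsCovering (suc r) s (λ j → π ⟨$⟩ʳ punchIn p j) lifted
  lifted-covering = isCovering-map Finₚ.suc-injective (λ eq → eq)
    (isCovering-pullback (λ j → j) (λ _ _ i<j → i<j) (λ _ _ → Equivalence.to (remove-<⇔ p π))
      (proj₂ covering))
  onlyAt-p : ∀ i → insertAt lifted p (inj₁ zero) i ≡ inj₁ zero → i ≡ p
  onlyAt-p i with punchView p i
  ... | at        = λ _ → refl
  ... | punched j = λ eq → contradiction (trans (sym (insertAt-punchIn lifted p (inj₁ zero) j)) eq) (lifted≢zero j)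

_≟ᶜ_ : (u v : Fin r ⊎ Fin s) → Dec (u ≡ v)
_≟ᶜ_ = Sumₚ.≡-dec Finₚ._≟_ Finₚ._≟_

pattern-avoiding-coverable : {π : Perm n} {σ : Perm m} {c : Fin n → Fin (suc r) ⊎ Fin s}
  (e : Contains π σ) (a : Fin (suc r)) → IsCovering (suc r) s (π ⟨$⟩ʳ_) c →
  (∀ i → c (proj₁ e i) ≢ inj₁ a) → Coverable r s σ
pattern-avoiding-coverable {π = π} {σ = σ} e a covering avoids =
  isCovering⇒coverable {π = σ} (isCovering-dropColour a avoids (isCovering-pattern {π = π} {σ = σ} e covering))

uncoverable-pattern-meets : {π : Perm n} {σ : Perm m} {c : Fin n → Fin (suc r) ⊎ Fin s}
  (e : Contains π σ) (a : Fin (suc r)) → IsCovering (suc r) s (π ⟨$⟩ʳ_) c →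
  ¬ Coverable r s σ → ∃ λ i → c (proj₁ e i) ≡ inj₁ a
uncoverable-pattern-meets {π = π} {σ = σ} {c = c} e a covering uncoverable
  with Finₚ.any? (λ i → c (proj₁ e i) ≟ᶜ inj₁ a)
... | yes meets  = meets
... | no  misses =
  contradiction (pattern-avoiding-coverable {π = π} {σ = σ} e a covering (λ i eq → misses (i , eq))) uncoverable

hits⇒≤ : (f : Fin m → Fin n) (g : Fin k → Fin n) → Injective _≡_ _≡_ g →
         (∀ p → ∃ λ i → f i ≡ g p) → k ≤ m
hits⇒≤ f g g-injective hits = Finₚ.injective⇒≤ {f = proj₁ ∘ hits} λ {p} {q} eq →
  g-injective (trans (sym (proj₂ (hits p))) (trans (cong f eq) (proj₂ (hits q))))

misses-point : m < n → (f : Fin m → Fin n) → ∃ λ p → ∀ i → f i ≢ p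
misses-point {n = n} m<n f =
  let p , unhit = Finₚ.¬∀⟶∃¬ n (λ p → ∃ λ i → f i ≡ p) (λ p → Finₚ.any? (λ i → f i Finₚ.≟ p))
                    (ℕ.<⇒≱ m<n ∘ hits⇒≤ f (λ p → p) (λ eq → eq))
  in p , λ i eq → unhit (i , eq)

classOrder? : (u : Fin r ⊎ Fin s) (x y : Fin N) → Dec (ClassOrder u x y)
classOrder? (inj₁ _) x y = x Finₚ.<? y
classOrder? (inj₂ _) x y = y Finₚ.<? x

isCovering? : (w : Fin n → Fin N) (c : Fin n → Fin r ⊎ Fin s) → Dec (IsCovering r s w c)
isCovering? w c = Finₚ.all? λ i → Finₚ.all? λ j →
  (i Finₚ.<? j) →-dec ((c i ≟ᶜ c j) →-dec classOrder? (c i) (w i) (w j))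

-- Colourings are enumerated as the elements of Fin ((r + s) ^ n).
coverable? : ∀ r s (π : Perm n) → Dec (Coverable r s π)
coverable? {n = n} r s π = map′ (isCovering⇒coverable {π = π} ∘ proj₂) encode
  (Finₚ.any? λ k → isCovering? (π ⟨$⟩ʳ_) (decode k))
  where
  decode : Fin ((r + s) ^ n) → Fin n → Fin r ⊎ Fin s
  decode k = splitAt r ∘ finToFun k
  decode-encode : ∀ c i → decode (funToFin (join r s ∘ c)) i ≡ c i
  decode-encode c i = trans (cong (splitAt r) (Finₚ.finToFun-funToFin (join r s ∘ c) i)) (Finₚ.splitAt-join r s (c i))
  encode : Coverable r s π → ∃ λ k → IsCovering r s (π ⟨$⟩ʳ_) (decode k)
  encode coverable =
    let c , covering = coverable⇒isCovering {π = π} coverable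
    in  funToFin (join r s ∘ c) , isCovering-cong (λ i → sym (decode-encode c i)) covering

kCoverable? : ∀ k (π : Perm n) → Dec (KCoverable k π)
kCoverable? k π = map′ fromSplit toSplit (Finₚ.any? λ (r : Fin (suc k)) → coverable? (toℕ r) (k ∸ toℕ r) π)
  where
  fromSplit : (∃ λ (r : Fin (suc k)) → Coverable (toℕ r) (k ∸ toℕ r) π) → KCoverable k π
  fromSplit (r , coverable) = toℕ r , k ∸ toℕ r , ℕ.m+[n∸m]≡n (ℕ.s≤s⁻¹ (Finₚ.toℕ<n r)) , coverable
  toSplit : KCoverable k π → ∃ λ (r : Fin (suc k)) → Coverable (toℕ r) (k ∸ toℕ r) π
  toSplit (r , s , r+s≡k , coverable) =
    fromℕ< r<1+k , subst₂ (λ r s → Coverable r s π) (sym toℕ-r) s≡ coverable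
    where
    r<1+k : r < suc k
    r<1+k = s≤s (subst (r ≤_) r+s≡k (ℕ.m≤m+n r s))
    toℕ-r : toℕ (fromℕ< r<1+k) ≡ r
    toℕ-r = Finₚ.toℕ-fromℕ< r<1+k
    s≡ : s ≡ k ∸ toℕ (fromℕ< r<1+k)
    s≡ = sym (trans (cong₂ _∸_ (sym r+s≡k) toℕ-r) (ℕ.m+n∸m≡n r s))

kCritical-pattern : ∀ k (τ : Perm n) → ¬ KCoverable k τ →
  ∃₂ λ m (σ : Perm m) → KCritical k σ × Contains τ σ
kCritical-pattern {n = zero} k τ uncoverable = zero , τ , (uncoverable , λ _ ()) , contains-refl τ
kCritical-pattern {n = suc n} k τ uncoverable with Finₚ.any? (λ p → ¬? (kCoverable? k (remove p τ)))
... | yes (p , uncoverable′) =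
  let m , σ , critical , e = kCritical-pattern k (remove p τ) uncoverable′
  in  m , σ , critical , contains-trans {π = τ} {ρ = remove p τ} {σ = σ} (contains-remove p τ) e
... | no removalsCoverable = suc n , τ , (uncoverable , properPatternsCoverable) , contains-refl τ
  where
  properPatternsCoverable : ∀ {m} (σ : Perm m) → m < suc n → Contains τ σ → KCoverable k σ
  properPatternsCoverable σ m<1+n e =
    let p , missed = misses-point m<1+n (proj₁ e)
        r , s , r+s≡k , removedCoverable =
          decidable-stable (kCoverable? k (remove p τ)) (λ uncoverable′ → removalsCoverable (p , uncoverable′))
        c , covering , onlyAt-p = remove-coverable⇒freshCovering p τ removedCoverable
    in  r , s , r+s≡k , pattern-avoiding-coverable {π = τ} {σ = σ} e zero covering (λ i → missed i ∘ onlyAt-p _)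

-- Direct and skew sums

_⊕_ : Perm m → Perm n → Perm (m + n)
π ⊕ ρ = ↔-trans Finₚ.+↔⊎ (↔-trans (π ⊎-↔ ρ) (↔-sym Finₚ.+↔⊎))

complement : Perm n → Perm n
complement π = π ∘ₚ permutation opposite opposite Finₚ.opposite-involutive Finₚ.opposite-involutive

_⊖_ : Perm m → Perm n → Perm (m + n)
π ⊖ ρ = complement (complement π ⊕ complement ρ)

data Split (m n : ℕ) : Fin (m + n) → Set where
  left  : (x : Fin m) → Split m n (x ↑ˡ n)
  right : (y : Fin n) → Split m n (m ↑ʳ y)

split : ∀ m n (i : Fin (m + n)) → Split m n i
split m n i with splitAt m i in eq
... | inj₁ x = subst (Split m n) (Finₚ.splitAt⁻¹-↑ˡ eq) (left x)
... | inj₂ y = subst (Split m n) (Finₚ.splitAt⁻¹-↑ʳ eq) (right y)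

↑ˡ-<⇔ : ∀ n {x y : Fin m} → (x <ᶠ y) ⇔ (x ↑ˡ n <ᶠ y ↑ˡ n)
↑ˡ-<⇔ n {x} {y} = mk⇔ (subst₂ ℕ._<_ (sym (Finₚ.toℕ-↑ˡ x n)) (sym (Finₚ.toℕ-↑ˡ y n)))
                      (subst₂ ℕ._<_ (Finₚ.toℕ-↑ˡ x n) (Finₚ.toℕ-↑ˡ y n))

↑ʳ-<⇔ : ∀ m {x y : Fin n} → (x <ᶠ y) ⇔ (m ↑ʳ x <ᶠ m ↑ʳ y)
↑ʳ-<⇔ m {x} {y} = mk⇔
  (subst₂ ℕ._<_ (sym (Finₚ.toℕ-↑ʳ m x)) (sym (Finₚ.toℕ-↑ʳ m y)) ∘ ℕ.+-monoʳ-< m)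
  (ℕ.+-cancelˡ-< m _ _ ∘ subst₂ ℕ._<_ (Finₚ.toℕ-↑ʳ m x) (Finₚ.toℕ-↑ʳ m y))

↑ˡ<↑ʳ : (x : Fin m) (y : Fin n) → x ↑ˡ n <ᶠ m ↑ʳ y
↑ˡ<↑ʳ {m = m} {n = n} x y = subst₂ ℕ._<_ (sym (Finₚ.toℕ-↑ˡ x n)) (sym (Finₚ.toℕ-↑ʳ m y))
  (ℕ.<-≤-trans (Finₚ.toℕ<n x) (ℕ.m≤m+n m (toℕ y)))

opposite-< : {i j : Fin n} → i <ᶠ j → opposite j <ᶠ opposite i
opposite-< {i = i} {j} i<j = subst₂ ℕ._<_ (sym (Finₚ.opposite-prop j)) (sym (Finₚ.opposite-prop i))
  (ℕ.∸-monoʳ-< (s≤s i<j) (Finₚ.toℕ<n j))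

opposite-<⇔ : {i j : Fin n} → (i <ᶠ j) ⇔ (opposite j <ᶠ opposite i)
opposite-<⇔ {i = i} {j} = mk⇔ opposite-<
  (subst₂ _<ᶠ_ (Finₚ.opposite-involutive i) (Finₚ.opposite-involutive j) ∘ opposite-<)

classOrder-mono : {f : Fin N → Fin N′} → (∀ {x y} → x <ᶠ y → f x <ᶠ f y) →
  (u : Fin r ⊎ Fin s) {x y : Fin N} → ClassOrder u x y → ClassOrder u (f x) (f y)
classOrder-mono f-mono (inj₁ _) = f-mono
classOrder-mono f-mono (inj₂ _) = f-mono

⊕-↑ˡ : (π : Perm m) (ρ : Perm n) (x : Fin m) → (π ⊕ ρ) ⟨$⟩ʳ (x ↑ˡ n) ≡ (π ⟨$⟩ʳ x) ↑ˡ n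
⊕-↑ˡ {m = m} {n = n} π ρ x rewrite Finₚ.splitAt-↑ˡ m x n = refl

⊕-↑ʳ : (π : Perm m) (ρ : Perm n) (y : Fin n) → (π ⊕ ρ) ⟨$⟩ʳ (m ↑ʳ y) ≡ m ↑ʳ (ρ ⟨$⟩ʳ y)
⊕-↑ʳ {m = m} {n = n} π ρ y rewrite Finₚ.splitAt-↑ʳ m n y = refl

⊕-containsˡ : (π : Perm m) (ρ : Perm n) → Contains (π ⊕ ρ) π
⊕-containsˡ {n = n} π ρ = (_↑ˡ n) , (λ _ _ → Equivalence.to (↑ˡ-<⇔ n)) , values
  where
  values : ∀ x y → (π ⟨$⟩ʳ x <ᶠ π ⟨$⟩ʳ y) ⇔ ((π ⊕ ρ) ⟨$⟩ʳ (x ↑ˡ n) <ᶠ (π ⊕ ρ) ⟨$⟩ʳ (y ↑ˡ n))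
  values x y rewrite ⊕-↑ˡ π ρ x | ⊕-↑ˡ π ρ y = ↑ˡ-<⇔ n

⊕-containsʳ : (π : Perm m) (ρ : Perm n) → Contains (π ⊕ ρ) ρ
⊕-containsʳ {m = m} π ρ = (m ↑ʳ_) , (λ _ _ → Equivalence.to (↑ʳ-<⇔ m)) , values
  where
  values : ∀ x y → (ρ ⟨$⟩ʳ x <ᶠ ρ ⟨$⟩ʳ y) ⇔ ((π ⊕ ρ) ⟨$⟩ʳ (m ↑ʳ x) <ᶠ (π ⊕ ρ) ⟨$⟩ʳ (m ↑ʳ y))
  values x y rewrite ⊕-↑ʳ π ρ x | ⊕-↑ʳ π ρ y = ↑ʳ-<⇔ m

⊕-isCovering : {π : Perm m} {ρ : Perm n} {c₁ : Fin m → Fin r ⊎ Fin s} {c₂ : Fin n → Fin r ⊎ Fin s} →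
  IsCovering r s (π ⟨$⟩ʳ_) c₁ → IsCovering r s (ρ ⟨$⟩ʳ_) c₂ →
  (∀ x y b → c₁ x ≡ inj₂ b → c₂ y ≢ inj₂ b) → IsCovering r s ((π ⊕ ρ) ⟨$⟩ʳ_) (c₁ ++ c₂)
⊕-isCovering {m = m} {n = n} {π = π} {ρ = ρ} {c₁} {c₂} covering₁ covering₂ noSharedDecreasing i j i<j same
  with split m n i | split m n j
... | left x | left y
  rewrite lookup-++ˡ c₁ c₂ x | lookup-++ˡ c₁ c₂ y | ⊕-↑ˡ π ρ x | ⊕-↑ˡ π ρ y =
  classOrder-mono (Equivalence.to (↑ˡ-<⇔ n)) (c₁ x)
    (covering₁ x y (Equivalence.from (↑ˡ-<⇔ n) i<j) same)
... | right x | right y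
  rewrite lookup-++ʳ c₁ c₂ x | lookup-++ʳ c₁ c₂ y | ⊕-↑ʳ π ρ x | ⊕-↑ʳ π ρ y =
  classOrder-mono (Equivalence.to (↑ʳ-<⇔ m)) (c₂ x)
    (covering₂ x y (Equivalence.from (↑ʳ-<⇔ m) i<j) same)
... | left x | right y
  rewrite lookup-++ˡ c₁ c₂ x | lookup-++ʳ c₁ c₂ y | ⊕-↑ˡ π ρ x | ⊕-↑ʳ π ρ y = across (c₁ x) refl same
  where
  across : ∀ u → c₁ x ≡ u → u ≡ c₂ y → ClassOrder u ((π ⟨$⟩ʳ x) ↑ˡ n) (m ↑ʳ (ρ ⟨$⟩ʳ y))
  across (inj₁ _) _   _   = ↑ˡ<↑ʳ _ _
  across (inj₂ b) c₁≡ c₂≡ = contradiction (sym c₂≡) (noSharedDecreasing x y b c₁≡)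
... | right x | left y = contradiction i<j (Finₚ.<-asym (↑ˡ<↑ʳ y x))

isCovering-complement : {π : Perm n} {c : Fin n → Fin r ⊎ Fin s} →
  IsCovering r s (π ⟨$⟩ʳ_) c → IsCovering s r (complement π ⟨$⟩ʳ_) (swap ∘ c)
isCovering-complement = isCovering-reverse (λ _ _ → opposite-<)

isCovering-complement⁻ : {π : Perm n} {c : Fin n → Fin r ⊎ Fin s} →
  IsCovering r s (complement π ⟨$⟩ʳ_) c → IsCovering s r (π ⟨$⟩ʳ_) (swap ∘ c)
isCovering-complement⁻ = isCovering-reverse (λ _ _ → Equivalence.from opposite-<⇔)

contains-complement : {π : Perm n} {σ : Perm m} → Contains π σ → Contains (complement π) (complement σ)
contains-complement (f , f-mono , f-iso) = f , f-mono , λ i j → opposite-<⇔ ⇔-∘ (f-iso j i ⇔-∘ ⇔-sym opposite-<⇔)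

contains-complement² : (π : Perm n) → Contains (complement (complement π)) π
contains-complement² π = (λ i → i) , (λ _ _ i<j → i<j) , λ _ _ → opposite-<⇔ ⇔-∘ opposite-<⇔

⊖-containsˡ : (π : Perm m) (ρ : Perm n) → Contains (π ⊖ ρ) π
⊖-containsˡ π ρ = contains-trans {π = π ⊖ ρ} {ρ = complement (complement π)} {σ = π}
  (contains-complement {π = complement π ⊕ complement ρ} {σ = complement π} (⊕-containsˡ (complement π) (complement ρ)))
  (contains-complement² π)

⊖-containsʳ : (π : Perm m) (ρ : Perm n) → Contains (π ⊖ ρ) ρ
⊖-containsʳ π ρ = contains-trans {π = π ⊖ ρ} {ρ = complement (complement ρ)} {σ = ρ}
  (contains-complement {π = complement π ⊕ complement ρ} {σ = complement ρ} (⊕-containsʳ (complement π) (complement ρ)))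
  (contains-complement² ρ)

⊖-↑ʳ<↑ˡ : (π : Perm m) (ρ : Perm n) (x : Fin m) (y : Fin n) → (π ⊖ ρ) ⟨$⟩ʳ (m ↑ʳ y) <ᶠ (π ⊖ ρ) ⟨$⟩ʳ (x ↑ˡ n)
⊖-↑ʳ<↑ˡ π ρ x y rewrite ⊕-↑ˡ (complement π) (complement ρ) x | ⊕-↑ʳ (complement π) (complement ρ) y =
  opposite-< (↑ˡ<↑ʳ _ _)

⊖-isCovering : {π : Perm m} {ρ : Perm n} {c₁ : Fin m → Fin r ⊎ Fin s} {c₂ : Fin n → Fin r ⊎ Fin s} →
  IsCovering r s (π ⟨$⟩ʳ_) c₁ → IsCovering r s (ρ ⟨$⟩ʳ_) c₂ →
  (∀ x y a → c₁ x ≡ inj₁ a → c₂ y ≢ inj₁ a) → IsCovering r s ((π ⊖ ρ) ⟨$⟩ʳ_) (c₁ ++ c₂)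
⊖-isCovering {m = m} {π = π} {ρ} {c₁} {c₂} covering₁ covering₂ noSharedIncreasing =
  isCovering-cong (λ i → swap-++ (splitAt m i))
    (isCovering-complement {π = complement π ⊕ complement ρ}
      (⊕-isCovering {π = complement π} {ρ = complement ρ}
        (isCovering-complement {π = π} covering₁) (isCovering-complement {π = ρ} covering₂) noSharedDecreasing))
  where
  swap≡inj₂ : {u : Fin r ⊎ Fin s} {b : Fin r} → swap u ≡ inj₂ b → u ≡ inj₁ b
  swap≡inj₂ {u = inj₁ _} refl = refl
  noSharedDecreasing : ∀ x y b → swap (c₁ x) ≡ inj₂ b → swap (c₂ y) ≢ inj₂ b
  noSharedDecreasing x y b c₁≡ c₂≡ = noSharedIncreasing x y b (swap≡inj₂ c₁≡) (swap≡inj₂ c₂≡)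
  swap-++ : ∀ u → swap ([ swap ∘ c₁ , swap ∘ c₂ ] u) ≡ [ c₁ , c₂ ] u
  swap-++ (inj₁ x) = Sumₚ.swap-involutive (c₁ x)
  swap-++ (inj₂ y) = Sumₚ.swap-involutive (c₂ y)

⊖-inj₁-disjoint : {π : Perm m} {ρ : Perm n} {c : Fin (m + n) → Fin r ⊎ Fin s} →
  IsCovering r s ((π ⊖ ρ) ⟨$⟩ʳ_) c → ∀ x y {a} → c (x ↑ˡ n) ≡ inj₁ a → c (m ↑ʳ y) ≢ inj₁ a
⊖-inj₁-disjoint {π = π} {ρ} covering x y cx≡ cy≡ =
  Finₚ.<-asym (subst (λ u → ClassOrder u _ _) cx≡ (covering _ _ (↑ˡ<↑ʳ x y) (trans cx≡ (sym cy≡))))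
              (⊖-↑ʳ<↑ˡ π ρ x y)

skewRuns : ∀ n M → Perm (n * M)
skewRuns zero    M = id
skewRuns (suc n) M = id ⊖ skewRuns n M

skewRuns-coverable : ∀ n M → ∃ λ (c : Fin (n * M) → Fin n) → IsCovering n s (skewRuns n M ⟨$⟩ʳ_) (inj₁ ∘ c)
skewRuns-coverable zero    M = (λ ()) , λ ()
skewRuns-coverable (suc n) M =
  let c , covering = skewRuns-coverable n M
  in  (λ _ → zero) ++ (suc ∘ c) ,
      isCovering-cong (λ i → sym (Sumₚ.[,]-∘ inj₁ (splitAt M i)))
        (⊖-isCovering {π = id} {ρ = skewRuns n M}
          (isCovering-constant (λ _ _ i<j → i<j) zero)
          (isCovering-map Finₚ.suc-injective (λ eq → eq) covering)
          λ { _ _ _ refl () })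

⊖-idˡ-inj₁ : {ρ : Perm n} {c : Fin (M + n) → Fin r ⊎ Fin s} →
  IsCovering r s ((id ⊖ ρ) ⟨$⟩ʳ_) c → r + s < M → ∃₂ λ x a → c (x ↑ˡ n) ≡ inj₁ a
⊖-idˡ-inj₁ {ρ = ρ} covering r+s<M = increasing-run-inj₁ (λ _ _ i<j → i<j) r+s<M
  (isCovering-pattern {π = id ⊖ ρ} {σ = id} (⊖-containsˡ id ρ) covering)

⊖-idʳ-inj₁ : {π : Perm m} {c : Fin (m + M) → Fin r ⊎ Fin s} →
  IsCovering r s ((π ⊖ id) ⟨$⟩ʳ_) c → r + s < M → ∃₂ λ y a → c (m ↑ʳ y) ≡ inj₁ a
⊖-idʳ-inj₁ {π = π} covering r+s<M = increasing-run-inj₁ (λ _ _ i<j → i<j) r+s<M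
  (isCovering-pattern {π = π ⊖ id} {σ = id} (⊖-containsʳ π id) covering)

skewRuns-forces : {c : Fin (n * M) → Fin r ⊎ Fin s} →
  IsCovering r s (skewRuns n M ⟨$⟩ʳ_) c → r + s < M → n ≤ r
skewRuns-forces {n = zero} _ _ = z≤n
skewRuns-forces {n = suc n} {M = M} {r = zero} covering r+s<M =
  ⊥-elim (Finₚ.¬Fin0 (proj₁ (proj₂ (⊖-idˡ-inj₁ {ρ = skewRuns n M} covering r+s<M))))
skewRuns-forces {n = suc n} {M = M} {r = suc r} covering r+s<M =
  let x , a , cx≡a = ⊖-idˡ-inj₁ {ρ = skewRuns n M} covering r+s<M
  in  s≤s (skewRuns-forces {n = n}
        (isCovering-dropColour a (λ y → ⊖-inj₁-disjoint {π = id} {ρ = skewRuns n M} covering x y cx≡a)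
          (isCovering-pattern {π = id ⊖ skewRuns n M} {σ = skewRuns n M} (⊖-containsʳ id (skewRuns n M)) covering))
        (ℕ.<-trans (ℕ.n<1+n _) r+s<M))

-- C(r,s) ≤ C(r+s)

critical⇒freshCovering : {π : Perm n} → (∀ {m} (σ : Perm m) → m < n → Contains π σ → Coverable r s σ) →
  (p : Fin n) → FreshCovering r s π p
critical⇒freshCovering {n = suc n} {π = π} properCoverable p =
  remove-coverable⇒freshCovering p π (properCoverable (remove p π) ℕ.≤-refl (contains-remove p π))

+-≤-≡⇒≡ : ∀ {r s r′ s′} → r ≤ r′ → s ≤ s′ → r′ + s′ ≡ r + s → r′ ≡ r × s′ ≡ s
+-≤-≡⇒≡ {r} {s} {r′} {s′} r≤r′ s≤s′ eq =
  ℕ.≤-antisym (ℕ.+-cancelʳ-≤ s r′ r (subst (r′ + s ≤_) eq (ℕ.+-monoʳ-≤ r′ s≤s′))) r≤r′ ,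
  ℕ.≤-antisym (ℕ.+-cancelˡ-≤ r s′ s (subst (r + s′ ≤_) eq (ℕ.+-monoˡ-≤ s′ r≤r′))) s≤s′

module RunsAround (r s : ℕ) {n : ℕ} (π : Perm n) where

  L : ℕ
  L = suc (r + s)

  E : Perm (s * L)
  E = complement (skewRuns s L)

  D : Perm (r * L)
  D = skewRuns r L

  τ : Perm ((n + s * L) + r * L)
  τ = (π ⊖ E) ⊕ D

  position : Fin n → Fin ((n + s * L) + r * L)
  position x = (x ↑ˡ (s * L)) ↑ˡ (r * L)

  position-injective : Injective _≡_ _≡_ position
  position-injective {x} {y} eq =
    Finₚ.↑ˡ-injective (s * L) x y (Finₚ.↑ˡ-injective (r * L) (x ↑ˡ (s * L)) (y ↑ˡ (s * L)) eq)

  π-in-τ : Contains τ π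
  π-in-τ = contains-trans {π = τ} {ρ = π ⊖ E} {σ = π} (⊕-containsˡ (π ⊖ E) D) (⊖-containsˡ π E)

  E-in-τ : Contains τ E
  E-in-τ = contains-trans {π = τ} {ρ = π ⊖ E} {σ = E} (⊕-containsˡ (π ⊖ E) D) (⊖-containsʳ π E)

  τ-covering-palette : {c : Fin ((n + s * L) + r * L) → Fin r′ ⊎ Fin s′} →
    IsCovering r′ s′ (τ ⟨$⟩ʳ_) c → r′ + s′ ≡ r + s → r′ ≡ r × s′ ≡ s
  τ-covering-palette {r′} {s′} covering r′+s′≡r+s = +-≤-≡⇒≡ r≤r′ s≤s′ r′+s′≡r+s
    where
    r′+s′<L : r′ + s′ < L
    r′+s′<L = s≤s (ℕ.≤-reflexive r′+s′≡r+s)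
    r≤r′ : r ≤ r′
    r≤r′ = skewRuns-forces {n = r}
      (isCovering-pattern {π = τ} {σ = D} (⊕-containsʳ (π ⊖ E) D) covering) r′+s′<L
    s≤s′ : s ≤ s′
    s≤s′ = skewRuns-forces {n = s}
      (isCovering-complement⁻ {π = skewRuns s L} (isCovering-pattern {π = τ} {σ = E} E-in-τ covering))
      (subst (_< L) (ℕ.+-comm r′ s′) r′+s′<L)

  τ-uncoverable : ¬ Coverable r s π → ¬ KCoverable (r + s) τ
  τ-uncoverable π-uncoverable (r′ , s′ , r′+s′≡r+s , coverable) =
    let c , covering = coverable⇒isCovering {π = τ} coverable
        r′≡r , s′≡s = τ-covering-palette covering r′+s′≡r+s
    in  π-uncoverable (subst₂ (λ r s → Coverable r s π) r′≡r s′≡s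
          (isCovering⇒coverable {π = π} (isCovering-pattern {π = τ} {σ = π} π-in-τ covering)))

  τ-freshCovering : {p : Fin n} → FreshCovering r s π p → FreshCovering r s τ (position p)
  τ-freshCovering {p} (c , covering , onlyAt-p) =
    colouring , τ-covering , onlyAt-position
    where
    cE : Fin (s * L) → Fin s
    cE = proj₁ (skewRuns-coverable {s = suc r} s L)
    cD : Fin (r * L) → Fin r
    cD = proj₁ (skewRuns-coverable {s = s} r L)
    colouring : Fin ((n + s * L) + r * L) → Fin (suc r) ⊎ Fin s
    colouring = (c ++ (inj₂ ∘ cE)) ++ (inj₁ ∘ suc ∘ cD)
    τ-covering : IsCovering (suc r) s (τ ⟨$⟩ʳ_) colouring
    τ-covering = ⊕-isCovering {π = π ⊖ E} {ρ = D}
      (⊖-isCovering {π = π} {ρ = E} covering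
        (isCovering-complement {π = skewRuns s L} (proj₂ (skewRuns-coverable s L)))
        λ _ _ _ _ ())
      (isCovering-map Finₚ.suc-injective (λ eq → eq) (proj₂ (skewRuns-coverable r L)))
      λ _ _ _ _ ()
    onlyAt-position : ∀ i → colouring i ≡ inj₁ zero → i ≡ position p
    onlyAt-position i with split (n + s * L) (r * L) i
    ... | right y rewrite lookup-++ʳ (c ++ (inj₂ ∘ cE)) (inj₁ ∘ suc ∘ cD) y = λ ()
    ... | left x′ rewrite lookup-++ˡ (c ++ (inj₂ ∘ cE)) (inj₁ ∘ suc ∘ cD) x′ with split n (s * L) x′
    ...   | right y rewrite lookup-++ʳ c (inj₂ ∘ cE) y = λ ()
    ...   | left x  rewrite lookup-++ˡ c (inj₂ ∘ cE) x = cong position ∘ onlyAt-p x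

  pattern-hits : (∀ {m} (σ : Perm m) → m < n → Contains π σ → Coverable r s σ) →
    {σ : Perm m} → ¬ Coverable r s σ → (e : Contains τ σ) → ∀ p → ∃ λ i → proj₁ e i ≡ position p
  pattern-hits properCoverable {σ = σ} σ-uncoverable e p =
    let c , covering , onlyAt = τ-freshCovering (critical⇒freshCovering {π = π} properCoverable p)
        i , ci≡0 = uncoverable-pattern-meets {π = τ} {σ = σ} e zero covering σ-uncoverable
    in  i , onlyAt _ ci≡0

C₂≤C : ∀ r s a b → IsC₂ r s a → IsC (r + s) b → a ≤ b
C₂≤C r s a b ((π , π-uncoverable , π-properCoverable) , _) (_ , C-greatest) =
  let m , σ , σ-critical , e = kCritical-pattern (r + s) τ (τ-uncoverable π-uncoverable)
  in  ℕ.≤-trans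
        (hits⇒≤ (proj₁ e) position position-injective
          (pattern-hits π-properCoverable {σ = σ} (proj₁ σ-critical ∘ λ coverable → r , s , refl , coverable) e))
        (C-greatest m (σ , σ-critical))
  where open RunsAround r s π

-- C(k) < C(k+1)

kCritical⇒freshCovering : {π : Perm n} → (∀ {m} (σ : Perm m) → m < n → Contains π σ → KCoverable k σ) →
  (p : Fin n) → ∃₂ λ r s → r + s ≡ k × FreshCovering r s π p
kCritical⇒freshCovering {n = suc n} {π = π} properCoverable p =
  let r , s , r+s≡k , coverable = properCoverable (remove p π) ℕ.≤-refl (contains-remove p π)
  in  r , s , r+s≡k , remove-coverable⇒freshCovering p π coverable

module RunBelow (k : ℕ) {n : ℕ} (π : Perm n) where

  L : ℕ
  L = suc (suc k)

  τ : Perm (n + L)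
  τ = π ⊖ id

  position : Fin n → Fin (n + L)
  position x = x ↑ˡ L

  τ-uncoverable : ¬ KCoverable k π → ¬ KCoverable (suc k) τ
  τ-uncoverable π-uncoverable (r′ , s′ , r′+s′≡1+k , coverable) with coverable⇒isCovering {π = τ} coverable
  ... | c , covering with ⊖-idʳ-inj₁ {π = π} covering (s≤s (ℕ.≤-reflexive r′+s′≡1+k))
  ...   | y , a , cy≡a with r′
  ...     | zero   = ⊥-elim (Finₚ.¬Fin0 a)
  ...     | suc r″ = π-uncoverable (r″ , s′ , ℕ.suc-injective r′+s′≡1+k ,
    isCovering⇒coverable {π = π}
      (isCovering-dropColour a (λ x cx≡a → ⊖-inj₁-disjoint {π = π} {ρ = id} covering x y cx≡a cy≡a)
        (isCovering-pattern {π = τ} {σ = π} (⊖-containsˡ π id) covering)))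

  τ-covering : ∀ {r s} {p : Fin n} → FreshCovering r s π p →
    Σ (Fin (n + L) → Fin (suc (suc r)) ⊎ Fin s) λ c → IsCovering (suc (suc r)) s (τ ⟨$⟩ʳ_) c ×
      (∀ i → c i ≡ inj₁ zero → i ≡ position p) × (∀ i → c i ≡ inj₁ (suc zero) → ∃ λ t → i ≡ n ↑ʳ t)
  τ-covering {r} {s} {p} (c , covering , onlyAt-p) = colouring , τ-isCovering , onlyAt-position , onlyOnRun
    where
    shift : Fin (suc r) ⊎ Fin s → Fin (suc (suc r)) ⊎ Fin s
    shift = Sum.map (punchIn (suc zero)) (λ b → b)
    shift≢one : ∀ u → shift u ≢ inj₁ (suc zero)
    shift≢one (inj₁ x) eq = Finₚ.punchInᵢ≢i (suc zero) x (Sumₚ.inj₁-injective eq)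
    shift≡zero : ∀ u → shift u ≡ inj₁ zero → u ≡ inj₁ zero
    shift≡zero (inj₁ x) eq = cong inj₁ (Finₚ.punchIn-injective (suc zero) x zero (Sumₚ.inj₁-injective eq))
    colouring : Fin (n + L) → Fin (suc (suc r)) ⊎ Fin s
    colouring = (shift ∘ c) ++ (λ _ → inj₁ (suc zero))
    τ-isCovering : IsCovering (suc (suc r)) s (τ ⟨$⟩ʳ_) colouring
    τ-isCovering = ⊖-isCovering {π = π} {ρ = id}
      (isCovering-map (Finₚ.punchIn-injective (suc zero) _ _) (λ eq → eq) covering)
      (isCovering-constant (λ _ _ i<j → i<j) (suc zero))
      λ { x _ _ shift≡a refl → shift≢one (c x) shift≡a }
    onlyAt-position : ∀ i → colouring i ≡ inj₁ zero → i ≡ position p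
    onlyAt-position i with split n L i
    ... | left x  = cong position ∘ onlyAt-p x ∘ shift≡zero (c x) ∘ trans (sym (lookup-++ˡ (shift ∘ c) _ x))
    ... | right t = λ one≡zero → contradiction (trans (sym (lookup-++ʳ (shift ∘ c) _ t)) one≡zero) λ ()
    onlyOnRun : ∀ i → colouring i ≡ inj₁ (suc zero) → ∃ λ t → i ≡ n ↑ʳ t
    onlyOnRun i with split n L i
    ... | left x  = ⊥-elim ∘ shift≢one (c x) ∘ trans (sym (lookup-++ˡ (shift ∘ c) _ x))
    ... | right t = λ _ → t , refl

  run∷position-injective : ∀ t → Injective _≡_ _≡_ ((n ↑ʳ t) ∷ position)
  run∷position-injective t {zero}  {zero}  _  = refl
  run∷position-injective t {zero}  {suc y} eq = contradiction (sym eq) (Finₚ.<⇒≢ (↑ˡ<↑ʳ y t))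
  run∷position-injective t {suc x} {zero}  eq = contradiction eq (Finₚ.<⇒≢ (↑ˡ<↑ʳ x t))
  run∷position-injective t {suc x} {suc y} eq = cong suc (Finₚ.↑ˡ-injective L x y eq)

  pattern-meets : (∀ {m} (σ : Perm m) → m < n → Contains π σ → KCoverable k σ) →
    {σ : Perm m} → ¬ KCoverable (suc k) σ → (e : Contains τ σ) (p : Fin n) →
    (∃ λ i → proj₁ e i ≡ position p) × (∃₂ λ i t → proj₁ e i ≡ n ↑ʳ t)
  pattern-meets properCoverable {σ = σ} σ-uncoverable e p =
    let r , s , r+s≡k , fresh = kCritical⇒freshCovering {π = π} properCoverable p
        c , covering , onlyAt-p , onlyOnRun = τ-covering fresh
        σ-uncoverable′ = σ-uncoverable ∘ λ coverable → suc r , s , cong suc r+s≡k , coverable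
        i , ci≡0 = uncoverable-pattern-meets {π = τ} {σ = σ} e zero covering σ-uncoverable′
        j , cj≡1 = uncoverable-pattern-meets {π = τ} {σ = σ} e (suc zero) covering σ-uncoverable′
    in  (i , onlyAt-p _ ci≡0) , (j , onlyOnRun _ cj≡1)

C<C-suc : ∀ k a b → IsC k a → IsC (suc k) b → a < b
C<C-suc k zero b ((π , π-uncoverable , _) , _) _ =
  ⊥-elim (π-uncoverable (k , 0 , ℕ.+-identityʳ k , (λ ()) , (λ ()) , (λ ())))
C<C-suc k (suc a) b ((π , π-uncoverable , π-properCoverable) , _) (_ , C-greatest) =
  let m , σ , σ-critical , e = kCritical-pattern (suc k) τ (τ-uncoverable π-uncoverable)
      meets = pattern-meets π-properCoverable {σ = σ} (proj₁ σ-critical) e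
      j , t , ej≡run = proj₂ (meets zero)
      hits : ∀ q → ∃ λ i → proj₁ e i ≡ ((suc a ↑ʳ t) ∷ position) q
      hits = λ { zero → j , ej≡run ; (suc p) → proj₁ (meets p) }
  in  ℕ.≤-trans (hits⇒≤ (proj₁ e) ((suc a ↑ʳ t) ∷ position) (run∷position-injective t) hits)
                (C-greatest m (σ , σ-critical))
  where open RunBelow k π

lemma9 : (∀ r s a b → IsC₂ r s a → IsC (r + s) b → a ≤ b)
       × (∀ k a b → IsC k a → IsC (suc k) b → a < b)
lemma9 = C₂≤C , C<C-suc
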